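{- Let $q\geq 3$ and let $k,\ell\in\mathbb{N}$. There is a graph $G$, a set of vertices $B=\{b_1,\dots,b_k\}\subseteq V(G)$ of size $k$, and color lists $L_v\subseteq[q]$ for all $v\in V(G)$, such that: \begin{itemize} \item $L_{b_i}=\{1,2\}$ for all $i\in[k]$; \item there are exactly $\ell$ list colorings $c$ of $G$ with $c(b_i)=1$ for all $i\in[k]$; \item for each map $c_B:B\to\{1,2\}$ with $c_B(b_i)=2$ for some $i$, there is a unique extension of $c_B$ to a list coloring of $G$. \end{itemize}
   Context: $\mathbb{N}=\{1,2,\dots\}$ and $[q]=\{1,\dots,q\}$. A list coloring of $G$ with lists $(L_v)$ is a map $c:V(G)\to[q]$ with $c(v)\in L_v$ for all $v$ and $c(u)\neq c(v)$ for every edge $uv$. -}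

module Defs where

open import Data.Nat using (ℕ; _≤_; s≤s; z≤n)
open import Data.Fin using (Fin; zero; suc)
open import Data.Fin.Subset using (Subset; _∈_; ⁅_⁆; _∪_)
open import Data.Vec using (Vec; lookup)
open import Data.List using (List; length)
open import Data.List.Relation.Unary.Unique.Propositional using (Unique)
import Data.List.Membership.Propositional as LM
open import Relation.Binary.PropositionalEquality using (_≡_; _≢_)
open import Relation.Nullary using (¬_)
open import Data.Product using (∃; _×_)
open import Function.Bundles using (_⇔_)

record SimpleGraph (n : ℕ) : Set₁ where
  field
    Adj    : Fin n → Fin n → Set
    sym    : ∀ {u v} → Adj u v → Adj v u
    irrefl : ∀ {v} → ¬ Adj v v
open SimpleGraph public

-- Colors [q] = {1,…,q} are represented by Fin q (color i ↦ Fin index i-1).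
-- Color 1 and color 2 (requires q ≥ 3, in particular q ≥ 2).
color1 : ∀ {q} → 3 ≤ q → Fin q
color1 (s≤s _) = zero

color2 : ∀ {q} → 3 ≤ q → Fin q
color2 (s≤s (s≤s _)) = suc zero

list12 : ∀ {q} → 3 ≤ q → Subset q
list12 h = ⁅ color1 h ⁆ ∪ ⁅ color2 h ⁆

IsListColoring : ∀ {n q} → SimpleGraph n → (Fin n → Subset q) → Vec (Fin q) n → Set
IsListColoring G L c =
  (∀ v → lookup c v ∈ L v) × (∀ u v → Adj G u v → lookup c u ≢ lookup c v)

HasExactly : ∀ {n q} → ℕ → (Vec (Fin q) n → Set) → Set
HasExactly {n} {q} ℓ P =
  ∃ λ (cs : List (Vec (Fin q) n)) →
    length cs ≡ ℓ × Unique cs × (∀ c → P c ⇔ c LM.∈ cs)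

-- Take q ≥ 3 and N = k + ℓ inputs P₀, …, P_{N-1} with lists {1,2}, the first k being b₁, …, b_k.
-- They feed a chain of OR-gadgets: state vertices S₀, …, S_N with lists {2,3} (S₀ only {2}),
-- color 3 meaning "on", and for each i a vertex R_i adjacent to S_i, S_{i+1} and P_i, plus
-- the edge S_{i+1}P_i. R_i needs a color in {1,2,3} missing from its three neighbors, which
-- forces S_{i+1} to be on exactly when S_i is on or P_i = 2, and then fixes R_i; so a coloring
-- is determined by its inputs. For the last ℓ gadgets R_i has list {1,3}, which forbids
-- "S_i on and P_i = 1", and a vertex T with list {2} adjacent to S_N forces S_N on.
-- If some b_i = 2 the chain is on before the last ℓ gadgets, so their inputs are all 2: exactly
-- one coloring. If all b_i = 1, the last ℓ inputs must read 1…12…2 with at least one 2: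
-- exactly ℓ colorings.

module Submission where

open import Defs hiding (sym)
open import Data.Nat using (ℕ; zero; suc; _+_; _≤_; s≤s; z≤n)
open import Data.Bool using (Bool; true; false; _∨_)
open import Data.Bool.Properties using (∨-assoc; ∨-identityʳ; ∨-zeroʳ)
open import Data.Fin using (Fin; zero; suc; inject₁; fromℕ; _↑ˡ_; _↑ʳ_; splitAt)
open import Data.Fin.Properties
  using (+↔⊎; ↑ˡ-injective; splitAt-↑ʳ; splitAt⁻¹-↑ʳ; join-splitAt)
open import Data.Fin.Induction using (<-weakInduction)
open import Data.Fin.Subset using (Subset; _∈_; ⁅_⁆; _∪_)
open import Data.Fin.Subset.Properties using (x∈⁅x⁆; x∈⁅y⁆⇒x≡y; x∈p∪q⁻; x∈p∪q⁺)
open import Data.Vec using (Vec; lookup; tabulate)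
open import Data.Vec.Properties using (lookup∘tabulate; tabulate∘lookup; tabulate-cong)
open import Data.Vec.Functional using (_++_; take; drop)
open import Data.Vec.Functional.Properties using (lookup-++ˡ; lookup-++ʳ; ++-cong)
import Data.List as List
open import Data.List.Properties using (length-tabulate)
open import Data.List.Membership.Propositional using () renaming (_∈_ to _∈ₗ_)
open import Data.List.Membership.Propositional.Properties using (∈-tabulate⁺; ∈-tabulate⁻)
open import Data.List.Relation.Unary.Unique.Propositional.Properties using (tabulate⁺)
open import Data.Product using (∃; ∃!; _×_; _,_; proj₁; proj₂; map₂)
open import Data.Sum as Sum using (_⊎_; inj₁; inj₂; [_,_]′; swap)
open import Data.Sum.Properties using ([,]-map; [,]-∘)
open import Data.Sum.Function.Propositional using (_⊎-↔_)
open import Function using (_∘_; _↔_; Inverse; Injection; mk⇔)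
open import Function.Definitions using (Injective)
open import Function.Properties.Inverse using (↔-refl; ↔-sym; ↔-trans; ↔⇒↣)
open import Relation.Nullary using (¬_; contradiction)
open import Relation.Binary.PropositionalEquality
  using (_≡_; _≢_; _≗_; refl; sym; trans; cong; cong₂; subst; subst₂; module ≡-Reasoning)

record IsColoring {V : Set} {q : ℕ} (E : V → V → Set) (L : V → Subset q) (f : V → Fin q) :
                  Set where
  field
    ∈-list : ∀ v → f v ∈ L v
    proper : ∀ {u v} → E u v → f u ≢ f v

IsColoring-resp : ∀ {V : Set} {q} {E : V → V → Set} {L : V → Subset q} {f g : V → Fin q} →
                  f ≗ g → IsColoring E L f → IsColoring E L g
IsColoring-resp {L = L} f≗g f-col = record
  { ∈-list = λ v → subst (_∈ L v) (f≗g v) (∈-list v)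
  ; proper = λ {u} {v} e eq → proper e (trans (f≗g u) (trans eq (sym (f≗g v))))
  }
  where open IsColoring f-col

module ViaBijection {V : Set} {n q : ℕ} (ι : V ↔ Fin n)
                    (E : V → V → Set) (E-irrefl : ∀ {v} → ¬ E v v) (L : V → Subset q) where
  open Inverse ι using (to; from; strictlyInverseˡ; strictlyInverseʳ)

  graph : SimpleGraph n
  graph = record
    { Adj    = λ x y → E (from x) (from y) ⊎ E (from y) (from x)
    ; sym    = swap
    ; irrefl = [ E-irrefl , E-irrefl ]′
    }

  lists : Fin n → Subset q
  lists = L ∘ from

  fromVec : Vec (Fin q) n → V → Fin q
  fromVec c = lookup c ∘ to

  toVec : (V → Fin q) → Vec (Fin q) n
  toVec f = tabulate (f ∘ from)

  fromVec-toVec : ∀ f → fromVec (toVec f) ≗ f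
  fromVec-toVec f v = trans (lookup∘tabulate (f ∘ from) (to v)) (cong f (strictlyInverseʳ v))

  fromVec-injective : ∀ {c c′} → fromVec c ≗ fromVec c′ → c ≡ c′
  fromVec-injective {c} {c′} eq = begin
    c                     ≡⟨ tabulate∘lookup c ⟨
    tabulate (lookup c)   ≡⟨ tabulate-cong lookup≗ ⟩
    tabulate (lookup c′)  ≡⟨ tabulate∘lookup c′ ⟩
    c′                    ∎
    where
    open ≡-Reasoning
    lookup≗ : lookup c ≗ lookup c′
    lookup≗ x = subst (λ y → lookup c y ≡ lookup c′ y) (strictlyInverseˡ x) (eq (from x))

  listColoring⇒coloring : ∀ {c} → IsListColoring graph lists c → IsColoring E L (fromVec c)
  listColoring⇒coloring {c} (∈lists , proper) = record
    { ∈-list = λ v → subst (λ w → lookup c (to v) ∈ L w) (strictlyInverseʳ v) (∈lists (to v))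
    ; proper = λ {u} {v} e → proper (to u) (to v)
                 (inj₁ (subst₂ E (sym (strictlyInverseʳ u)) (sym (strictlyInverseʳ v)) e))
    }

  coloring⇒listColoring : ∀ {f} → IsColoring E L f → IsListColoring graph lists (toVec f)
  coloring⇒listColoring {f} f-col = ∈lists , proper′
    where
    open IsColoring f-col
    lookup-toVec : ∀ x → lookup (toVec f) x ≡ f (from x)
    lookup-toVec = lookup∘tabulate (f ∘ from)
    ∈lists : ∀ x → lookup (toVec f) x ∈ lists x
    ∈lists x = subst (_∈ lists x) (sym (lookup-toVec x)) (∈-list (from x))
    proper′ : ∀ x y → Adj graph x y → lookup (toVec f) x ≢ lookup (toVec f) y
    proper′ x y (inj₁ e) eq =
      proper e (trans (sym (lookup-toVec x)) (trans eq (lookup-toVec y)))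
    proper′ x y (inj₂ e) eq =
      proper e (trans (sym (lookup-toVec y)) (trans (sym eq) (lookup-toVec x)))

hasExactly-tabulate : ∀ {n q ℓ} {P : Vec (Fin q) n → Set} (g : Fin ℓ → Vec (Fin q) n) →
                      Injective _≡_ _≡_ g →
                      (∀ c → P c → ∃ λ j → c ≡ g j) → (∀ j → P (g j)) →
                      HasExactly ℓ P
hasExactly-tabulate {P = P} g g-injective complete sound =
  List.tabulate g , length-tabulate g , tabulate⁺ g-injective ,
  λ c → mk⇔ (listed c) (solution c)
  where
  listed : ∀ c → P c → c ∈ₗ List.tabulate g
  listed c Pc with j , refl ← complete c Pc = ∈-tabulate⁺ j
  solution : ∀ c → c ∈ₗ List.tabulate g → P c
  solution c c∈ with j , refl ← ∈-tabulate⁻ c∈ = sound j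

∈-pair⁻ : ∀ {n} {x} (a b : Fin n) → x ∈ ⁅ a ⁆ ∪ ⁅ b ⁆ → x ≡ a ⊎ x ≡ b
∈-pair⁻ a b = Sum.map (x∈⁅y⁆⇒x≡y a) (x∈⁅y⁆⇒x≡y b) ∘ x∈p∪q⁻ ⁅ a ⁆ ⁅ b ⁆

∈-pair⁺ : ∀ {n} {x} (a b : Fin n) → x ≡ a ⊎ x ≡ b → x ∈ ⁅ a ⁆ ∪ ⁅ b ⁆
∈-pair⁺ a b = x∈p∪q⁺ ∘ Sum.map (λ { refl → x∈⁅x⁆ a }) (λ { refl → x∈⁅x⁆ b })

∈-triple⁻ : ∀ {n} {x} (a b c : Fin n) →
            x ∈ ⁅ a ⁆ ∪ (⁅ b ⁆ ∪ ⁅ c ⁆) → x ≡ a ⊎ x ≡ b ⊎ x ≡ c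
∈-triple⁻ a b c = Sum.map (x∈⁅y⁆⇒x≡y a) (∈-pair⁻ b c) ∘ x∈p∪q⁻ ⁅ a ⁆ (⁅ b ⁆ ∪ ⁅ c ⁆)

∈-triple⁺ : ∀ {n} {x} (a b c : Fin n) →
            x ≡ a ⊎ x ≡ b ⊎ x ≡ c → x ∈ ⁅ a ⁆ ∪ (⁅ b ⁆ ∪ ⁅ c ⁆)
∈-triple⁺ a b c = x∈p∪q⁺ ∘ Sum.map (λ { refl → x∈⁅x⁆ a }) (∈-pair⁺ b c)

anyBefore : ∀ {N} → (Fin N → Bool) → Fin (suc N) → Bool
anyBefore p zero = false
anyBefore {suc N} p (suc x) = p zero ∨ anyBefore (p ∘ suc) x

anyBefore-cong : ∀ {N} {p p′ : Fin N → Bool} → p ≗ p′ → anyBefore p ≗ anyBefore p′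
anyBefore-cong p≗p′ zero = refl
anyBefore-cong {suc N} p≗p′ (suc x) =
  cong₂ _∨_ (p≗p′ zero) (anyBefore-cong (p≗p′ ∘ suc) x)

anyBefore-suc : ∀ {N} (p : Fin N → Bool) i →
                anyBefore p (suc i) ≡ anyBefore p (inject₁ i) ∨ p i
anyBefore-suc p zero = ∨-identityʳ (p zero)
anyBefore-suc p (suc i) =
  trans (cong (p zero ∨_) (anyBefore-suc (p ∘ suc) i)) (sym (∨-assoc (p zero) _ _))

anyBefore-unique : ∀ {N} (p : Fin N → Bool) (s : Fin (suc N) → Bool) →
                   s zero ≡ false → (∀ i → s (suc i) ≡ s (inject₁ i) ∨ p i) → s ≗ anyBefore p
anyBefore-unique p s s₀ step = <-weakInduction (λ x → s x ≡ anyBefore p x) s₀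
  (λ i ih → trans (step i) (trans (cong (_∨ p i) ih) (sym (anyBefore-suc p i))))

anyBefore-fromℕ : ∀ {N} (p : Fin N → Bool) i → p i ≡ true → anyBefore p (fromℕ N) ≡ true
anyBefore-fromℕ {suc N} p zero pᵢ = cong (_∨ anyBefore (p ∘ suc) (fromℕ N)) pᵢ
anyBefore-fromℕ p (suc i) pᵢ =
  trans (cong (p zero ∨_) (anyBefore-fromℕ (p ∘ suc) i pᵢ)) (∨-zeroʳ (p zero))

anyBefore-false : ∀ {N} x → anyBefore {N} (λ _ → false) x ≡ false
anyBefore-false zero = refl
anyBefore-false {suc N} (suc x) = anyBefore-false x

++-suc : ∀ {k ℓ} (β : Fin (suc k) → Bool) (t : Fin ℓ → Bool) →
         (β ++ t) ∘ suc ≗ (β ∘ suc) ++ t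
++-suc {k} β t i = [,]-map (splitAt k i)

anyBefore-++-inject₁ : ∀ {k ℓ} (β : Fin k → Bool) (t : Fin ℓ → Bool) m →
  anyBefore (β ++ t) (inject₁ (k ↑ʳ m)) ≡ anyBefore β (fromℕ k) ∨ anyBefore t (inject₁ m)
anyBefore-++-inject₁ {zero} β t m = refl
anyBefore-++-inject₁ {suc k} β t m = begin
  β zero ∨ anyBefore ((β ++ t) ∘ suc) (inject₁ (k ↑ʳ m))
    ≡⟨ cong (β zero ∨_) (anyBefore-cong (++-suc β t) (inject₁ (k ↑ʳ m))) ⟩
  β zero ∨ anyBefore ((β ∘ suc) ++ t) (inject₁ (k ↑ʳ m))
    ≡⟨ cong (β zero ∨_) (anyBefore-++-inject₁ (β ∘ suc) t m) ⟩
  β zero ∨ (anyBefore (β ∘ suc) (fromℕ k) ∨ anyBefore t (inject₁ m))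
    ≡⟨ ∨-assoc (β zero) _ _ ⟨
  (β zero ∨ anyBefore (β ∘ suc) (fromℕ k)) ∨ anyBefore t (inject₁ m)
    ∎
  where open ≡-Reasoning

anyBefore-++-fromℕ : ∀ {k ℓ} (β : Fin k → Bool) (t : Fin ℓ → Bool) →
  anyBefore (β ++ t) (fromℕ (k + ℓ)) ≡ anyBefore β (fromℕ k) ∨ anyBefore t (fromℕ ℓ)
anyBefore-++-fromℕ {zero} β t = refl
anyBefore-++-fromℕ {suc k} {ℓ} β t = begin
  β zero ∨ anyBefore ((β ++ t) ∘ suc) (fromℕ (k + ℓ))
    ≡⟨ cong (β zero ∨_) (anyBefore-cong (++-suc β t) (fromℕ (k + ℓ))) ⟩
  β zero ∨ anyBefore ((β ∘ suc) ++ t) (fromℕ (k + ℓ))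
    ≡⟨ cong (β zero ∨_) (anyBefore-++-fromℕ (β ∘ suc) t) ⟩
  β zero ∨ (anyBefore (β ∘ suc) (fromℕ k) ∨ anyBefore t (fromℕ ℓ))
    ≡⟨ ∨-assoc (β zero) _ _ ⟨
  (β zero ∨ anyBefore (β ∘ suc) (fromℕ k)) ∨ anyBefore t (fromℕ ℓ)
    ∎
  where open ≡-Reasoning

take-++-drop : ∀ {k ℓ} (p : Fin (k + ℓ) → Bool) → p ≗ take k p ++ drop k p
take-++-drop {k} {ℓ} p i = trans (cong p (sym (join-splitAt k ℓ i))) ([,]-∘ p (splitAt k i))

-- Run from state s through inputs t, the OR-chain ends on and never reads false while on.
AcceptsFrom : ∀ {ℓ} → Bool → (Fin ℓ → Bool) → Set
AcceptsFrom {ℓ} s t =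
  s ∨ anyBefore t (fromℕ ℓ) ≡ true × (∀ m → s ∨ anyBefore t (inject₁ m) ≡ true → t m ≡ true)

stepAt : ∀ {ℓ} → Fin ℓ → Fin ℓ → Bool
stepAt zero    _       = true
stepAt (suc j) zero    = false
stepAt (suc j) (suc m) = stepAt j m

stepAt-injective : ∀ {ℓ} {j j′ : Fin ℓ} → stepAt j ≗ stepAt j′ → j ≡ j′
stepAt-injective {j = zero}  {zero}    _ = refl
stepAt-injective {j = zero}  {suc j′}  eq with () ← eq zero
stepAt-injective {j = suc j} {zero}    eq with () ← eq zero
stepAt-injective {j = suc j} {suc j′}  eq = cong suc (stepAt-injective (eq ∘ suc))

stepAt-acceptsFrom : ∀ {ℓ} (j : Fin ℓ) → AcceptsFrom false (stepAt j)
stepAt-acceptsFrom zero    = refl , λ _ _ → refl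
stepAt-acceptsFrom (suc j) = proj₁ (stepAt-acceptsFrom j) , closed
  where
  closed : ∀ m → anyBefore (stepAt (suc j)) (inject₁ m) ≡ true → stepAt (suc j) m ≡ true
  closed zero    ()
  closed (suc m) = proj₂ (stepAt-acceptsFrom j) m

acceptsFrom⇒stepAt : ∀ {ℓ} (t : Fin ℓ → Bool) → AcceptsFrom false t → ∃ λ j → t ≗ stepAt j
acceptsFrom⇒stepAt {zero}  t (() , _)
acceptsFrom⇒stepAt {suc ℓ} t (on , closed) with t zero in t₀
... | true  = zero , all-true
  where
  all-true : ∀ m → t m ≡ true
  all-true zero    = t₀
  all-true (suc m) = closed (suc m) (cong (_∨ anyBefore (t ∘ suc) (inject₁ m)) t₀)
... | false = suc (proj₁ shifted) , t≗
  where
  shifted : ∃ λ j → t ∘ suc ≗ stepAt j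
  shifted = acceptsFrom⇒stepAt (t ∘ suc) (on , closed′)
    where
    closed′ : ∀ m → anyBefore (t ∘ suc) (inject₁ m) ≡ true → t (suc m) ≡ true
    closed′ m h = closed (suc m) (trans (cong (_∨ anyBefore (t ∘ suc) (inject₁ m)) t₀) h)
  t≗ : t ≗ stepAt (suc (proj₁ shifted))
  t≗ zero    = t₀
  t≗ (suc m) = proj₂ shifted m

module Colors (r : ℕ) where
  q : ℕ
  q = 3 + r

  c₁ c₂ c₃ : Fin q
  c₁ = zero
  c₂ = suc zero
  c₃ = suc (suc zero)

  sColor pColor : Bool → Fin q
  sColor false = c₂
  sColor true  = c₃
  pColor false = c₁
  pColor true  = c₂

  -- The color of {1,2,3} left free by sColor a, pColor b and sColor (a ∨ b).
  rColor : Bool → Bool → Fin q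
  rColor false false = c₃
  rColor false true  = c₁
  rColor true  false = c₂
  rColor true  true  = c₁

  sBit pBit : Fin q → Bool
  sBit (suc (suc zero)) = true
  sBit _                = false
  pBit (suc zero) = true
  pBit _          = false

  sColor-sBit : ∀ {x} → x ≡ c₂ ⊎ x ≡ c₃ → sColor (sBit x) ≡ x
  sColor-sBit (inj₁ refl) = refl
  sColor-sBit (inj₂ refl) = refl

  pColor-pBit : ∀ {x} → x ≡ c₁ ⊎ x ≡ c₂ → pColor (pBit x) ≡ x
  pColor-pBit (inj₁ refl) = refl
  pColor-pBit (inj₂ refl) = refl

  pBit-pColor : ∀ b → pBit (pColor b) ≡ b
  pBit-pColor false = refl
  pBit-pColor true  = refl

  pColor-injective : ∀ {a b} → pColor a ≡ pColor b → a ≡ b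
  pColor-injective {a} {b} eq = trans (sym (pBit-pColor a)) (trans (cong pBit eq) (pBit-pColor b))

  sColor≢c₂ : ∀ {a} → sColor a ≢ c₂ → a ≡ true
  sColor≢c₂ {false} ≢c₂ = contradiction refl ≢c₂
  sColor≢c₂ {true}  _   = refl

  sColor∈ : ∀ a → sColor a ∈ ⁅ c₂ ⁆ ∪ ⁅ c₃ ⁆
  sColor∈ false = ∈-pair⁺ c₂ c₃ (inj₁ refl)
  sColor∈ true  = ∈-pair⁺ c₂ c₃ (inj₂ refl)

  pColor∈ : ∀ b → pColor b ∈ ⁅ c₁ ⁆ ∪ ⁅ c₂ ⁆
  pColor∈ false = ∈-pair⁺ c₁ c₂ (inj₁ refl)
  pColor∈ true  = ∈-pair⁺ c₁ c₂ (inj₂ refl)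

  rColor∈ : ∀ a b → rColor a b ∈ ⁅ c₁ ⁆ ∪ (⁅ c₂ ⁆ ∪ ⁅ c₃ ⁆)
  rColor∈ false false = ∈-triple⁺ c₁ c₂ c₃ (inj₂ (inj₂ refl))
  rColor∈ false true  = ∈-triple⁺ c₁ c₂ c₃ (inj₁ refl)
  rColor∈ true  false = ∈-triple⁺ c₁ c₂ c₃ (inj₂ (inj₁ refl))
  rColor∈ true  true  = ∈-triple⁺ c₁ c₂ c₃ (inj₁ refl)

  rColor∈c₁c₃ : ∀ a b → (a ≡ true → b ≡ true) → rColor a b ∈ ⁅ c₁ ⁆ ∪ ⁅ c₃ ⁆
  rColor∈c₁c₃ false false _ = ∈-pair⁺ c₁ c₃ (inj₂ refl)
  rColor∈c₁c₃ false true  _ = ∈-pair⁺ c₁ c₃ (inj₁ refl)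
  rColor∈c₁c₃ true  false h with () ← h refl
  rColor∈c₁c₃ true  true  _ = ∈-pair⁺ c₁ c₃ (inj₁ refl)

  rColor∈c₁c₃⁻ : ∀ a b → rColor a b ∈ ⁅ c₁ ⁆ ∪ ⁅ c₃ ⁆ → a ≡ true → b ≡ true
  rColor∈c₁c₃⁻ true false r∈ refl = [ (λ ()) , (λ ()) ]′ (∈-pair⁻ c₁ c₃ r∈)
  rColor∈c₁c₃⁻ true true  _  refl = refl

  gadget-proper : ∀ a b → sColor a ≢ rColor a b × sColor (a ∨ b) ≢ rColor a b
                        × sColor (a ∨ b) ≢ pColor b × pColor b ≢ rColor a b
  gadget-proper false false = (λ ()) , (λ ()) , (λ ()) , (λ ())
  gadget-proper false true  = (λ ()) , (λ ()) , (λ ()) , (λ ())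
  gadget-proper true  false = (λ ()) , (λ ()) , (λ ()) , (λ ())
  gadget-proper true  true  = (λ ()) , (λ ()) , (λ ()) , (λ ())

  gadget-forced : ∀ a b c {x} → x ≡ c₁ ⊎ x ≡ c₂ ⊎ x ≡ c₃ →
                 sColor a ≢ x → sColor c ≢ x → pColor b ≢ x → sColor c ≢ pColor b →
                 c ≡ a ∨ b × x ≡ rColor a b
  gadget-forced false false false (inj₁ refl)        _  _  p≢ _  = contradiction refl p≢
  gadget-forced false false false (inj₂ (inj₁ refl)) a≢ _  _  _  = contradiction refl a≢
  gadget-forced false false false (inj₂ (inj₂ refl)) _  _  _  _  = refl , refl
  gadget-forced false false true  (inj₁ refl)        _  _  p≢ _  = contradiction refl p≢
  gadget-forced false false true  (inj₂ (inj₁ refl)) a≢ _  _  _  = contradiction refl a≢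
  gadget-forced false false true  (inj₂ (inj₂ refl)) _  c≢ _  _  = contradiction refl c≢
  gadget-forced false true  false _                  _  _  _  c≢p = contradiction refl c≢p
  gadget-forced false true  true  (inj₁ refl)        _  _  _  _  = refl , refl
  gadget-forced false true  true  (inj₂ (inj₁ refl)) a≢ _  _  _  = contradiction refl a≢
  gadget-forced false true  true  (inj₂ (inj₂ refl)) _  c≢ _  _  = contradiction refl c≢
  gadget-forced true  false false (inj₁ refl)        _  _  p≢ _  = contradiction refl p≢
  gadget-forced true  false false (inj₂ (inj₁ refl)) _  c≢ _  _  = contradiction refl c≢
  gadget-forced true  false false (inj₂ (inj₂ refl)) a≢ _  _  _  = contradiction refl a≢
  gadget-forced true  false true  (inj₁ refl)        _  _  p≢ _  = contradiction refl p≢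
  gadget-forced true  false true  (inj₂ (inj₁ refl)) _  _  _  _  = refl , refl
  gadget-forced true  false true  (inj₂ (inj₂ refl)) a≢ _  _  _  = contradiction refl a≢
  gadget-forced true  true  false _                  _  _  _  c≢p = contradiction refl c≢p
  gadget-forced true  true  true  (inj₁ refl)        _  _  _  _  = refl , refl
  gadget-forced true  true  true  (inj₂ (inj₁ refl)) _  _  p≢ _  = contradiction refl p≢
  gadget-forced true  true  true  (inj₂ (inj₂ refl)) a≢ _  _  _  = contradiction refl a≢

module Construction (r k ℓ : ℕ) where
  open Colors r

  N : ℕ
  N = k + ℓ

  Vertex : Set
  Vertex = Fin (suc N) ⊎ Fin N ⊎ Fin N ⊎ Fin 1

  -- S x is the state after the first x gadgets; P i and R i are the input and the auxiliary
  -- vertex of gadget i.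
  pattern S x = inj₁ x
  pattern P i = inj₂ (inj₁ i)
  pattern R i = inj₂ (inj₂ (inj₁ i))
  pattern T   = inj₂ (inj₂ (inj₂ zero))

  data Edge : Vertex → Vertex → Set where
    S-R  : ∀ i → Edge (S (inject₁ i)) (R i)
    S′-R : ∀ i → Edge (S (suc i)) (R i)
    S′-P : ∀ i → Edge (S (suc i)) (P i)
    P-R  : ∀ i → Edge (P i) (R i)
    S-T  : Edge (S (fromℕ N)) T

  Edge-irrefl : ∀ {v} → ¬ Edge v v
  Edge-irrefl ()

  rList : Fin k ⊎ Fin ℓ → Subset q
  rList (inj₁ _) = ⁅ c₁ ⁆ ∪ (⁅ c₂ ⁆ ∪ ⁅ c₃ ⁆)
  rList (inj₂ _) = ⁅ c₁ ⁆ ∪ ⁅ c₃ ⁆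

  rList⊆c₁c₂c₃ : ∀ s {x} → x ∈ rList s → x ≡ c₁ ⊎ x ≡ c₂ ⊎ x ≡ c₃
  rList⊆c₁c₂c₃ (inj₁ _) = ∈-triple⁻ c₁ c₂ c₃
  rList⊆c₁c₂c₃ (inj₂ _) = [ inj₁ , inj₂ ∘ inj₂ ]′ ∘ ∈-pair⁻ c₁ c₃

  list : Vertex → Subset q
  list (S zero)    = ⁅ c₂ ⁆
  list (S (suc _)) = ⁅ c₂ ⁆ ∪ ⁅ c₃ ⁆
  list (P _)       = ⁅ c₁ ⁆ ∪ ⁅ c₂ ⁆
  list (R i)       = rList (splitAt k i)
  list T           = ⁅ c₂ ⁆

  colorFor : (Fin N → Bool) → Vertex → Fin q
  colorFor p (S x) = sColor (anyBefore p x)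
  colorFor p (P i) = pColor (p i)
  colorFor p (R i) = rColor (anyBefore p (inject₁ i)) (p i)
  colorFor p T     = c₂

  colorFor-cong : ∀ {p p′} → p ≗ p′ → colorFor p ≗ colorFor p′
  colorFor-cong p≗p′ (S x) = cong sColor (anyBefore-cong p≗p′ x)
  colorFor-cong p≗p′ (P i) = cong pColor (p≗p′ i)
  colorFor-cong p≗p′ (R i) = cong₂ rColor (anyBefore-cong p≗p′ (inject₁ i)) (p≗p′ i)
  colorFor-cong p≗p′ T     = refl

  Accepts : (Fin N → Bool) → Set
  Accepts p = anyBefore p (fromℕ N) ≡ true
            × (∀ m → anyBefore p (inject₁ (k ↑ʳ m)) ≡ true → p (k ↑ʳ m) ≡ true)

  accepts⇒acceptsFrom : ∀ β t → Accepts (β ++ t) → AcceptsFrom (anyBefore β (fromℕ k)) t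
  accepts⇒acceptsFrom β t (on , closed) =
    trans (sym (anyBefore-++-fromℕ β t)) on ,
    λ m h → trans (sym (lookup-++ʳ β t m)) (closed m (trans (anyBefore-++-inject₁ β t m) h))

  acceptsFrom⇒accepts : ∀ β t → AcceptsFrom (anyBefore β (fromℕ k)) t → Accepts (β ++ t)
  acceptsFrom⇒accepts β t (on , closed) =
    trans (anyBefore-++-fromℕ β t) on ,
    λ m h → trans (lookup-++ʳ β t m) (closed m (trans (sym (anyBefore-++-inject₁ β t m)) h))

  colorFor-isColoring : ∀ {p} → Accepts p → IsColoring Edge list (colorFor p)
  colorFor-isColoring {p} (on , closed) = record { ∈-list = ∈-list ; proper = proper }
    where
    ∈-list : ∀ v → colorFor p v ∈ list v
    ∈-list (S zero)    = x∈⁅x⁆ c₂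
    ∈-list (S (suc x)) = sColor∈ _
    ∈-list (P i)       = pColor∈ (p i)
    ∈-list (R i) with splitAt k i in eq
    ... | inj₁ _ = rColor∈ _ _
    ... | inj₂ m = rColor∈c₁c₃ _ _
      (subst (λ j → anyBefore p (inject₁ j) ≡ true → p j ≡ true)
             (splitAt⁻¹-↑ʳ eq) (closed m))
    ∈-list T           = x∈⁅x⁆ c₂
    proper : ∀ {u v} → Edge u v → colorFor p u ≢ colorFor p v
    proper (S-R i)  = proj₁ (gadget-proper _ _)
    proper (S′-R i) rewrite anyBefore-suc p i = proj₁ (proj₂ (gadget-proper _ _))
    proper (S′-P i) rewrite anyBefore-suc p i = proj₁ (proj₂ (proj₂ (gadget-proper _ _)))
    proper (P-R i)  = proj₂ (proj₂ (proj₂ (gadget-proper _ _)))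
    proper S-T      rewrite on = λ ()

  colorFor-accepts : ∀ {p} → IsColoring Edge list (colorFor p) → Accepts p
  colorFor-accepts {p} col = sColor≢c₂ (proper S-T) , closed
    where
    open IsColoring col
    closed : ∀ m → anyBefore p (inject₁ (k ↑ʳ m)) ≡ true → p (k ↑ʳ m) ≡ true
    closed m = rColor∈c₁c₃⁻ _ _
      (subst (λ s → colorFor p (R (k ↑ʳ m)) ∈ rList s)
             (splitAt-↑ʳ k ℓ m) (∈-list (R (k ↑ʳ m))))

  inputs : (Vertex → Fin q) → Fin N → Bool
  inputs f i = pBit (f (P i))

  coloring≗colorFor : ∀ {f} → IsColoring Edge list f → f ≗ colorFor (inputs f)
  coloring≗colorFor {f} col = λ where
      (S x) → trans (S-state x) (cong sColor (state≗ x))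
      (P i) → P-input i
      (R i) → trans (proj₂ (gadget-at i))
                    (cong (λ a → rColor a (inputs f i)) (state≗ (inject₁ i)))
      T     → x∈⁅y⁆⇒x≡y c₂ (∈-list T)
    where
    open IsColoring col
    state : Fin (suc N) → Bool
    state x = sBit (f (S x))
    S₀ : f (S zero) ≡ c₂
    S₀ = x∈⁅y⁆⇒x≡y c₂ (∈-list (S zero))
    S-state : ∀ x → f (S x) ≡ sColor (state x)
    S-state zero    = sym (sColor-sBit (inj₁ S₀))
    S-state (suc x) = sym (sColor-sBit (∈-pair⁻ c₂ c₃ (∈-list (S (suc x)))))
    P-input : ∀ i → f (P i) ≡ pColor (inputs f i)
    P-input i = sym (pColor-pBit (∈-pair⁻ c₁ c₂ (∈-list (P i))))
    gadget-at : ∀ i → state (suc i) ≡ state (inject₁ i) ∨ inputs f i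
                    × f (R i) ≡ rColor (state (inject₁ i)) (inputs f i)
    gadget-at i = gadget-forced _ _ _ (rList⊆c₁c₂c₃ (splitAt k i) (∈-list (R i)))
      (λ e → proper (S-R i) (trans (S-state (inject₁ i)) e))
      (λ e → proper (S′-R i) (trans (S-state (suc i)) e))
      (λ e → proper (P-R i) (trans (P-input i) e))
      (λ e → proper (S′-P i) (trans (S-state (suc i)) (trans e (sym (P-input i)))))
    state≗ : state ≗ anyBefore (inputs f)
    state≗ = anyBefore-unique (inputs f) state (cong sBit S₀) (proj₁ ∘ gadget-at)

  freeInputs : (Vertex → Fin q) → Fin k → Bool
  freeInputs f = take k (inputs f)

  thresholdInputs : (Vertex → Fin q) → Fin ℓ → Bool
  thresholdInputs f = drop k (inputs f)

  freeInputs≗ : ∀ f {β} → (∀ i → f (P (i ↑ˡ ℓ)) ≡ pColor (β i)) → freeInputs f ≗ β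
  freeInputs≗ f {β} b≡β i = trans (cong pBit (b≡β i)) (pBit-pColor (β i))

  coloring-decomposes : ∀ {f} → IsColoring Edge list f →
    f ≗ colorFor (freeInputs f ++ thresholdInputs f)
    × AcceptsFrom (anyBefore (freeInputs f) (fromℕ k)) (thresholdInputs f)
  coloring-decomposes {f} col =
    f≗ , accepts⇒acceptsFrom (freeInputs f) (thresholdInputs f)
                             (colorFor-accepts (IsColoring-resp f≗ col))
    where
    f≗ : f ≗ colorFor (freeInputs f ++ thresholdInputs f)
    f≗ v = trans (coloring≗colorFor col v) (colorFor-cong (take-++-drop {k} (inputs f)) v)

  stepColoring : Fin ℓ → Vertex → Fin q
  stepColoring j = colorFor ((λ _ → false) ++ stepAt j)

  stepColoring-isColoring : ∀ j → IsColoring Edge list (stepColoring j)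
  stepColoring-isColoring j = colorFor-isColoring (acceptsFrom⇒accepts (λ _ → false) (stepAt j)
    (subst (λ s → AcceptsFrom s (stepAt j)) (sym (anyBefore-false (fromℕ k)))
           (stepAt-acceptsFrom j)))

  coloring⇒stepColoring : ∀ {f} → IsColoring Edge list f → (∀ i → f (P (i ↑ˡ ℓ)) ≡ c₁) →
                          ∃ λ j → f ≗ stepColoring j
  coloring⇒stepColoring {f} col b≡c₁ =
    map₂ (λ t≗ v → trans (f≗ v) (colorFor-cong (++-cong (freeInputs f) (λ _ → false) β≗ t≗) v))
         (acceptsFrom⇒stepAt (thresholdInputs f)
                             (subst (λ s → AcceptsFrom s (thresholdInputs f)) off accepts))
    where
    f≗ : f ≗ colorFor (freeInputs f ++ thresholdInputs f)
    f≗ = proj₁ (coloring-decomposes col)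
    accepts : AcceptsFrom (anyBefore (freeInputs f) (fromℕ k)) (thresholdInputs f)
    accepts = proj₂ (coloring-decomposes col)
    β≗ : freeInputs f ≗ λ _ → false
    β≗ = freeInputs≗ f b≡c₁
    off : anyBefore (freeInputs f) (fromℕ k) ≡ false
    off = trans (anyBefore-cong β≗ (fromℕ k)) (anyBefore-false (fromℕ k))

  fullColoring : (Fin k → Bool) → Vertex → Fin q
  fullColoring β = colorFor (β ++ λ _ → true)

  fullColoring-isColoring : ∀ β → anyBefore β (fromℕ k) ≡ true →
                            IsColoring Edge list (fullColoring β)
  fullColoring-isColoring β on = colorFor-isColoring (acceptsFrom⇒accepts β (λ _ → true)
    (cong (_∨ anyBefore {ℓ} (λ _ → true) (fromℕ ℓ)) on , λ _ _ → refl))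

  coloring⇒fullColoring : ∀ {f} β → anyBefore β (fromℕ k) ≡ true → IsColoring Edge list f →
                          (∀ i → f (P (i ↑ˡ ℓ)) ≡ pColor (β i)) → f ≗ fullColoring β
  coloring⇒fullColoring {f} β on col b≡β with f≗ , (_ , closed) ← coloring-decomposes col =
    λ v → trans (f≗ v) (colorFor-cong (++-cong (freeInputs f) β β≗ t≗) v)
    where
    β≗ : freeInputs f ≗ β
    β≗ = freeInputs≗ f b≡β
    t≗ : thresholdInputs f ≗ λ _ → true
    t≗ m = closed m (cong (_∨ anyBefore (thresholdInputs f) (inject₁ m))
                          (trans (anyBefore-cong β≗ (fromℕ k)) on))

  n : ℕ
  n = suc N + (N + (N + 1))

  vertices : Vertex ↔ Fin n
  vertices = ↔-sym (↔-trans +↔⊎ (↔-refl ⊎-↔ ↔-trans +↔⊎ (↔-refl ⊎-↔ +↔⊎)))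

  open Inverse vertices using (to; strictlyInverseʳ)
  open ViaBijection vertices Edge Edge-irrefl list public

  b : Fin k → Fin n
  b i = to (P (i ↑ˡ ℓ))

  b-injective : Injective _≡_ _≡_ b
  b-injective = ↑ˡ-injective ℓ _ _ ∘ P-injective ∘ Injection.injective (↔⇒↣ vertices)
    where
    P-injective : ∀ {i j} → P i ≡ P j → i ≡ j
    P-injective refl = refl

  lists-b : ∀ i → lists (b i) ≡ ⁅ c₁ ⁆ ∪ ⁅ c₂ ⁆
  lists-b i = cong list (strictlyInverseʳ (P (i ↑ˡ ℓ)))

  count : HasExactly ℓ (λ c → IsListColoring graph lists c × (∀ i → lookup c (b i) ≡ c₁))
  count = hasExactly-tabulate (toVec ∘ stepColoring) injective complete sound
    where
    P-stepColoring : ∀ j m → fromVec (toVec (stepColoring j)) (P (k ↑ʳ m)) ≡ pColor (stepAt j m)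
    P-stepColoring j m = trans (fromVec-toVec (stepColoring j) (P (k ↑ʳ m)))
                               (cong pColor (lookup-++ʳ {m = k} (λ _ → false) (stepAt j) m))
    injective : Injective _≡_ _≡_ (toVec ∘ stepColoring)
    injective {j} {j′} eq = stepAt-injective λ m → pColor-injective (begin
      pColor (stepAt j m)                             ≡⟨ P-stepColoring j m ⟨
      fromVec (toVec (stepColoring j)) (P (k ↑ʳ m))   ≡⟨ cong (λ c → fromVec c (P (k ↑ʳ m))) eq ⟩
      fromVec (toVec (stepColoring j′)) (P (k ↑ʳ m))  ≡⟨ P-stepColoring j′ m ⟩
      pColor (stepAt j′ m)                            ∎)
      where open ≡-Reasoning
    complete : ∀ c → IsListColoring graph lists c × (∀ i → lookup c (b i) ≡ c₁) →
               ∃ λ j → c ≡ toVec (stepColoring j)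
    complete c (c-col , b≡c₁)
      with j , c≗ ← coloring⇒stepColoring (listColoring⇒coloring {c} c-col) b≡c₁ =
      j , fromVec-injective λ v → trans (c≗ v) (sym (fromVec-toVec (stepColoring j) v))
    sound : ∀ j → IsListColoring graph lists (toVec (stepColoring j))
                × (∀ i → lookup (toVec (stepColoring j)) (b i) ≡ c₁)
    sound j = coloring⇒listColoring (stepColoring-isColoring j) ,
              λ i → trans (fromVec-toVec (stepColoring j) (P (i ↑ˡ ℓ)))
                          (cong pColor (lookup-++ˡ (λ _ → false) (stepAt j) i))

  extension : ∀ (cB : Fin k → Fin q) → (∀ i → cB i ≡ c₁ ⊎ cB i ≡ c₂) → (∃ λ i → cB i ≡ c₂) →
              ∃! _≡_ (λ c → IsListColoring graph lists c × (∀ i → lookup c (b i) ≡ cB i))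
  extension cB cB∈ (i₀ , cBi₀≡c₂) =
    toVec (fullColoring β) , (coloring⇒listColoring (fullColoring-isColoring β on) , b≡cB) , unique
    where
    β : Fin k → Bool
    β = pBit ∘ cB
    on : anyBefore β (fromℕ k) ≡ true
    on = anyBefore-fromℕ β i₀ (cong pBit cBi₀≡c₂)
    β-colors : ∀ i → pColor (β i) ≡ cB i
    β-colors i = pColor-pBit (cB∈ i)
    b≡cB : ∀ i → lookup (toVec (fullColoring β)) (b i) ≡ cB i
    b≡cB i = trans (fromVec-toVec (fullColoring β) (P (i ↑ˡ ℓ)))
                   (trans (cong pColor (lookup-++ˡ β (λ _ → true) i)) (β-colors i))
    unique : ∀ {c} → IsListColoring graph lists c × (∀ i → lookup c (b i) ≡ cB i) →
             toVec (fullColoring β) ≡ c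
    unique {c} (c-col , c-b≡cB) = fromVec-injective λ v →
      trans (fromVec-toVec (fullColoring β) v) (sym (c≗ v))
      where
      c≗ : fromVec c ≗ fullColoring β
      c≗ = coloring⇒fullColoring β on (listColoring⇒coloring {c} c-col)
                                 (λ i → trans (c-b≡cB i) (sym (β-colors i)))

lemma23 : ∀ (q : ℕ) (h : 3 ≤ q) (k ℓ : ℕ) →
    ∃ λ (n : ℕ) → ∃ λ (G : SimpleGraph n) → ∃ λ (b : Fin k → Fin n) →
      ∃ λ (L : Fin n → Subset q) →
        Injective _≡_ _≡_ b
        × (∀ i → L (b i) ≡ list12 h)
        × HasExactly ℓ (λ c → IsListColoring G L c × (∀ i → lookup c (b i) ≡ color1 h))
        × (∀ (cB : Fin k → Fin q) →
             (∀ i → cB i ≡ color1 h ⊎ cB i ≡ color2 h) →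
             (∃ λ i → cB i ≡ color2 h) →
             ∃! _≡_ (λ c → IsListColoring G L c × (∀ i → lookup c (b i) ≡ cB i)))
lemma23 (suc (suc (suc r))) (s≤s (s≤s (s≤s z≤n))) k ℓ =
  n , graph , b , lists , b-injective , lists-b , count , extension
  where open Construction r k ℓ
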